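{- Let $g$ be the morphism on $A_6=\{a,b,c,d,e,f\}$ defined by $g(a)=abac$, $g(b)=babd$, $g(c)=eabdf$, $g(d)=fbace$, $g(e)=bace$, $g(f)=abdf$. Then the infinite fixed point $\mathbf{g}=g^\infty(a)$ is square-free, i.e. the morphism $g$ is weakly square-free.
   Context: $g^\infty(a)$ denotes the infinite word having every $g^k(a)$, $k\ge 1$, as a prefix. A word is square-free if it has no factor of the form $ww$ with $w$ nonempty. A morphism is called weakly square-free if the infinite word it generates by iteration (here $g^\infty(a)$) is square-free. -}

module Defs where

open import Data.Nat using (ℕ; zero; suc; _+_; _<_)
open import Data.List using (List; []; _∷_; concatMap; lookup; length)
open import Data.Maybe using (Maybe; just; nothing)
open import Data.Product using (∃; _×_; _,_)
open import Data.Sum using (_⊎_)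
open import Relation.Binary.PropositionalEquality using (_≡_)
open import Relation.Nullary using (¬_)

data A₆ : Set where
  a b c d e f : A₆

g₁ : A₆ → List A₆
g₁ a = a ∷ b ∷ a ∷ c ∷ []
g₁ b = b ∷ a ∷ b ∷ d ∷ []
g₁ c = e ∷ a ∷ b ∷ d ∷ f ∷ []
g₁ d = f ∷ b ∷ a ∷ c ∷ e ∷ []
g₁ e = b ∷ a ∷ c ∷ e ∷ []
g₁ f = a ∷ b ∷ d ∷ f ∷ []

g : List A₆ → List A₆
g = concatMap g₁

g^ : ℕ → List A₆ → List A₆
g^ zero w = w
g^ (suc k) w = g (g^ k w)

_!!_ : List A₆ → ℕ → Maybe A₆
[] !! _ = nothing
(x ∷ xs) !! zero = just x
(x ∷ xs) !! suc n = xs !! n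

InfWord : Set
InfWord = ℕ → A₆

-- 𝐰 is g^∞(a): every gᵏ(a), k ≥ 1, is a prefix of 𝐰,
-- i.e. every position of gᵏ(a) carries the same letter in 𝐰.
IsFixedPointFrom-a : InfWord → Set
IsFixedPointFrom-a 𝐰 = ∀ k i → g^ (suc k) (a ∷ []) !! i ≡ nothing ⊎ (g^ (suc k) (a ∷ []) !! i ≡ just (𝐰 i))

SquareFree : InfWord → Set
SquareFree 𝐰 = ¬ (∃ λ i → ∃ λ n → (0 < n) × (∀ j → j < n → 𝐰 (i + j) ≡ 𝐰 (i + n + j)))

module Submission where

-- The prefixes Pₖ = gᵏ(a) extend one another; W, read off them letter by letter, is the unique
-- infinite word having all of them as prefixes, and it is fixed by g: W is the concatenation of
-- the images g₁(W 0) g₁(W 1) …, the image of the m-th letter starting at position cut m.  Since every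
-- letter image has length 4 or 5, consecutive cuts are 4 or 5 apart.
--
-- We show more: W has no near-square x y x with |y| = k ≤ 3 and |x| > threshold k; threshold 0 = 0,
-- so W has no square.  Short near-squares (|x| ≤ 62) are excluded by a finite search: every factor
-- of length 33 of W lies in a list computed from P 4 (it is closed under g), and a short near-square
-- lies inside the image of such a factor.  A long near-square (|x| ≥ 63) is desubstituted: the
-- window of five letters ending at a cut near the start of the first copy is recognised as ending
-- at a cut in the second copy too (a finite check on the factors of length 3), and since the first
-- three letters of an image determine the letter, the blocks of the first copy are copied block by
-- block.  These blocks form a near-square x' y' x' with 10 < |x'| < |x| and |y'| ≤ 3, so
-- well-founded induction on |x| concludes.

open import Defs
open import Data.Nat using (ℕ; zero; suc; _+_; _*_; _∸_; _≤_; _<_; z≤n; s≤s; _<?_; _≤?_)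
open import Data.Nat.Properties hiding (_≟_)
open import Data.Nat.Induction using (<-wellFounded)
open import Data.Nat.Tactic.RingSolver using (solve-∀)
open import Induction.WellFounded using (Acc; acc)
open import Data.Bool using (true)
open import Data.Maybe using (just; nothing; fromMaybe)
open import Data.Maybe.Properties using (just-injective)
open import Data.List using (List; []; _∷_; _++_; length; take; drop; upTo; map; deduplicate)
open import Data.List.Properties using (++-assoc; ++-identityʳ; length-++; concatMap-++; ++-cancelˡ; take++drop≡id; ≡-dec)
open import Data.List.Relation.Unary.All using (All; all?; lookup)
open import Data.List.Relation.Unary.All.Properties using (applyUpTo⁻)
open import Data.Product using (∃; _×_; _,_; proj₁; proj₂)
open import Data.Sum using (inj₁; inj₂)
open import Data.Empty using (⊥-elim)
open import Function using (_∘′_; case_of_)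
open import Function.Bundles using (mk↣)
open import Relation.Binary.Definitions using (DecidableEquality)
open import Relation.Binary.PropositionalEquality
open import Relation.Nullary using (¬_; Dec; yes; no; does; ¬?)
open import Relation.Nullary.Decidable using (_→-dec_)

g-++ : ∀ (u v : List A₆) → g (u ++ v) ≡ g u ++ g v
g-++ = concatMap-++ g₁

image-length : ∀ x → 4 ≤ length (g₁ x) × length (g₁ x) ≤ 5
image-length a = ≤-refl , n≤1+n 4
image-length b = ≤-refl , n≤1+n 4
image-length c = n≤1+n 4 , ≤-refl
image-length d = n≤1+n 4 , ≤-refl
image-length e = ≤-refl , n≤1+n 4
image-length f = ≤-refl , n≤1+n 4

image-nonempty : ∀ x → 0 < length (g₁ x)
image-nonempty x = ≤-trans (s≤s z≤n) (proj₁ (image-length x))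

length-g≥ : ∀ u → 4 * length u ≤ length (g u)
length-g≥ [] = z≤n
length-g≥ (x ∷ u) = begin
  4 * suc (length u)         ≡⟨ *-suc 4 (length u) ⟩
  4 + 4 * length u           ≤⟨ +-mono-≤ (proj₁ (image-length x)) (length-g≥ u) ⟩
  length (g₁ x) + length (g u) ≡⟨ length-++ (g₁ x) ⟨
  length (g (x ∷ u))         ∎
  where open ≤-Reasoning

length-g≤ : ∀ u → length (g u) ≤ 5 * length u
length-g≤ [] = z≤n
length-g≤ (x ∷ u) = begin
  length (g (x ∷ u))           ≡⟨ length-++ (g₁ x) ⟩
  length (g₁ x) + length (g u) ≤⟨ +-mono-≤ (proj₂ (image-length x)) (length-g≤ u) ⟩
  5 + 5 * length u             ≡⟨ *-suc 5 (length u) ⟨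
  5 * suc (length u)           ∎
  where open ≤-Reasoning

P : ℕ → List A₆
P k = g^ k (a ∷ [])

P-extends : ∀ k → ∃ λ r → P (suc k) ≡ P k ++ r
P-extends zero = b ∷ a ∷ c ∷ [] , refl
P-extends (suc k) with r , eq ← P-extends k = g r , trans (cong g eq) (g-++ (P k) r)

P-chain : ∀ k t → ∃ λ r → P (t + k) ≡ P k ++ r
P-chain k zero = [] , sym (++-identityʳ (P k))
P-chain k (suc t) with r , eq ← P-chain k t | r' , eq' ← P-extends (t + k) =
  r ++ r' , trans eq' (trans (cong (_++ r') eq) (++-assoc (P k) r r'))

P-long : ∀ k → k < length (P k)
P-long zero = s≤s z≤n
P-long (suc k) = begin-strict
  suc k                      ≤⟨ P-long k ⟩
  length (P k)               <⟨ m<m+n (length (P k)) (≤-trans (s≤s z≤n) (P-long k)) ⟩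
  length (P k) + length (P k) ≤⟨ +-monoʳ-≤ (length (P k)) (m≤m+n (length (P k)) _) ⟩
  4 * length (P k)           ≤⟨ length-g≥ (P k) ⟩
  length (P (suc k))         ∎
  where open ≤-Reasoning

W : InfWord
W p = fromMaybe a (P (suc p) !! p)

!!-++ : ∀ (l r : List A₆) p → p < length l → (l ++ r) !! p ≡ l !! p
!!-++ (x ∷ l) r zero _ = refl
!!-++ (x ∷ l) r (suc p) (s≤s h) = !!-++ l r p h

!!-defined : ∀ (l : List A₆) p → p < length l → l !! p ≡ just (fromMaybe a (l !! p))
!!-defined (x ∷ l) zero _ = refl
!!-defined (x ∷ l) (suc p) (s≤s h) = !!-defined l p h

!!-beyond : ∀ (l : List A₆) p → length l ≤ p → l !! p ≡ nothing
!!-beyond [] p _ = refl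
!!-beyond (x ∷ l) (suc p) (s≤s h) = !!-beyond l p h

P-stable : ∀ {k k'} p → k ≤ k' → p < length (P k) → P k' !! p ≡ P k !! p
P-stable {k} p k≤k' h with t , refl ← m≤n⇒∃[o]m+o≡n k≤k' with r , eq ← P-chain k t = begin
  P (k + t) !! p        ≡⟨ cong (λ j → P j !! p) (+-comm k t) ⟩
  P (t + k) !! p        ≡⟨ cong (_!! p) eq ⟩
  (P k ++ r) !! p       ≡⟨ !!-++ (P k) r p h ⟩
  P k !! p              ∎
  where open ≡-Reasoning

P-covers : ∀ p → p < length (P (suc p))
P-covers p = <-trans (n<1+n p) (P-long (suc p))

P-letter : ∀ k p → p < length (P k) → P k !! p ≡ just (W p)
P-letter k p h with ≤-total k (suc p)
... | inj₁ k≤ = trans (!!-defined (P k) p h) (cong (just ∘′ fromMaybe a) (sym (P-stable p k≤ h)))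
... | inj₂ ≤k = trans (P-stable p ≤k (P-covers p)) (!!-defined (P (suc p)) p (P-covers p))

fixedPoint : IsFixedPointFrom-a W
fixedPoint k p with p <? length (P (suc k))
... | yes h = inj₂ (P-letter (suc k) p h)
... | no h = inj₁ (!!-beyond (P (suc k)) p (≮⇒≥ h))

fixedPoint-unique : ∀ (𝐠 : InfWord) → IsFixedPointFrom-a 𝐠 → ∀ p → W p ≡ 𝐠 p
fixedPoint-unique 𝐠 h𝐠 p with h𝐠 p p | P-letter (suc p) p (P-covers p)
... | inj₁ undefined | defined = case trans (sym undefined) defined of λ ()
... | inj₂ h | defined = just-injective (trans (sym defined) h)

factor : ℕ → ℕ → List A₆
factor p zero = []
factor p (suc n) = W p ∷ factor (suc p) n

length-factor : ∀ p n → length (factor p n) ≡ n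
length-factor p zero = refl
length-factor p (suc n) = cong suc (length-factor (suc p) n)

factor-+ : ∀ p m n → factor p (m + n) ≡ factor p m ++ factor (p + m) n
factor-+ p zero n = cong (λ q → factor q n) (sym (+-identityʳ p))
factor-+ p (suc m) n = cong (W p ∷_) (trans (factor-+ (suc p) m n) (cong (λ q → factor (suc p) m ++ factor q n) (sym (+-suc p m))))

take-factor : ∀ p {n L} → n ≤ L → take n (factor p L) ≡ factor p n
take-factor p {zero} _ = refl
take-factor p {suc n} {suc L} (s≤s n≤L) = cong (W p ∷_) (take-factor (suc p) n≤L)

drop-factor : ∀ p o L → drop o (factor p L) ≡ factor (p + o) (L ∸ o)
drop-factor p zero L = cong (λ q → factor q L) (sym (+-identityʳ p))
drop-factor p (suc o) zero = refl
drop-factor p (suc o) (suc L) = trans (drop-factor (suc p) o L) (cong (λ q → factor q (L ∸ o)) (sym (+-suc p o)))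

slice-factor : ∀ p o {n L} → o + n ≤ L → take n (drop o (factor p L)) ≡ factor (p + o) n
slice-factor p o {n} {L} h = trans (cong (take n) (drop-factor p o L)) (take-factor (p + o) (+-cancelˡ-≤ o n (L ∸ o) (≤-trans h (m≤n+m∸n L o))))

take-agreeing : ∀ (l : List A₆) p n → n ≤ length l → (∀ j → j < length l → l !! j ≡ just (W (p + j))) → take n l ≡ factor p n
take-agreeing l p zero _ _ = refl
take-agreeing (x ∷ l) p (suc n) (s≤s n≤l) agrees = cong₂ _∷_ head-agrees (take-agreeing l (suc p) n n≤l tail-agrees)
  where
  head-agrees : x ≡ W p
  head-agrees = just-injective (trans (agrees 0 (s≤s z≤n)) (cong (just ∘′ W) (+-identityʳ p)))
  tail-agrees : ∀ j → j < length l → l !! j ≡ just (W (suc p + j))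
  tail-agrees j j< = trans (agrees (suc j) (s≤s j<)) (cong (just ∘′ W) (+-suc p j))

take-P : ∀ k n → n ≤ length (P k) → take n (P k) ≡ factor 0 n
take-P k n h = take-agreeing (P k) 0 n h (P-letter k)

-- cut m is the position where the image of the m-th letter of W starts; these are the cuts of W.
cut : ℕ → ℕ
cut m = length (g (factor 0 m))

take-++ˡ : ∀ (u v : List A₆) → take (length u) (u ++ v) ≡ u
take-++ˡ [] v = refl
take-++ˡ (x ∷ u) v = cong (x ∷_) (take-++ˡ u v)

g-prefix : ∀ n → g (factor 0 n) ≡ factor 0 (cut n)
g-prefix n = begin
  g (factor 0 n)                          ≡⟨ take-++ˡ (g (factor 0 n)) (g rest) ⟨
  take (cut n) (g (factor 0 n) ++ g rest) ≡⟨ cong (take (cut n)) image-split ⟩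
  take (cut n) (P (suc n))                ≡⟨ take-P (suc n) (cut n) cut≤ ⟩
  factor 0 (cut n)                        ∎
  where
  open ≡-Reasoning
  rest = drop n (P n)
  image-split : g (factor 0 n) ++ g rest ≡ P (suc n)
  image-split = begin
    g (factor 0 n) ++ g rest   ≡⟨ g-++ (factor 0 n) rest ⟨
    g (factor 0 n ++ rest)     ≡⟨ cong (g ∘′ (_++ rest)) (take-P n n (<⇒≤ (P-long n))) ⟨
    g (take n (P n) ++ rest)   ≡⟨ cong g (take++drop≡id n (P n)) ⟩
    P (suc n)                  ∎
  cut≤ : cut n ≤ length (P (suc n))
  cut≤ = ≤-trans (m≤m+n (cut n) (length (g rest)))
                 (≤-reflexive (trans (sym (length-++ (g (factor 0 n)))) (cong length image-split)))

cut-+ : ∀ m t → cut (m + t) ≡ cut m + length (g (factor m t))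
cut-+ m t = trans (cong (length ∘′ g) (factor-+ 0 m t))
                  (trans (cong length (g-++ (factor 0 m) (factor m t))) (length-++ (g (factor 0 m))))

g-factor : ∀ m t → g (factor m t) ≡ factor (cut m) (length (g (factor m t)))
g-factor m t = ++-cancelˡ (factor 0 (cut m)) _ _ (begin
  factor 0 (cut m) ++ g (factor m t)          ≡⟨ cong (_++ g (factor m t)) (g-prefix m) ⟨
  g (factor 0 m) ++ g (factor m t)            ≡⟨ g-++ (factor 0 m) (factor m t) ⟨
  g (factor 0 m ++ factor m t)                ≡⟨ cong g (factor-+ 0 m t) ⟨
  g (factor 0 (m + t))                        ≡⟨ g-prefix (m + t) ⟩
  factor 0 (cut (m + t))                      ≡⟨ cong (factor 0) (cut-+ m t) ⟩
  factor 0 (cut m + length (g (factor m t)))  ≡⟨ factor-+ 0 (cut m) _ ⟩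
  factor 0 (cut m) ++ factor (cut m) (length (g (factor m t))) ∎)
  where open ≡-Reasoning

cut-suc : ∀ m → cut (suc m) ≡ cut m + length (g₁ (W m))
cut-suc m = trans (cong cut (+-comm 1 m)) (trans (cut-+ m 1) (cong (λ l → cut m + length l) (++-identityʳ (g₁ (W m)))))

cuts-lower : ∀ m t → cut m + 4 * t ≤ cut (m + t)
cuts-lower m t = begin
  cut m + 4 * t                               ≡⟨ cong (λ l → cut m + 4 * l) (length-factor m t) ⟨
  cut m + 4 * length (factor m t)             ≤⟨ +-monoʳ-≤ (cut m) (length-g≥ (factor m t)) ⟩
  cut m + length (g (factor m t))             ≡⟨ cut-+ m t ⟨
  cut (m + t)                                 ∎
  where open ≤-Reasoning

cuts-upper : ∀ m t → cut (m + t) ≤ cut m + 5 * t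
cuts-upper m t = begin
  cut (m + t)                                 ≡⟨ cut-+ m t ⟩
  cut m + length (g (factor m t))             ≤⟨ +-monoʳ-≤ (cut m) (length-g≤ (factor m t)) ⟩
  cut m + 5 * length (factor m t)             ≡⟨ cong (λ l → cut m + 5 * l) (length-factor m t) ⟩
  cut m + 5 * t                               ∎
  where open ≤-Reasoning

cut-mono-< : ∀ {m m'} → m < m' → cut m < cut m'
cut-mono-< {m} {m'} m<m' with t , refl ← m≤n⇒∃[o]m+o≡n m<m' = begin-strict
  cut m                 <⟨ m<m+n (cut m) (s≤s z≤n) ⟩
  cut m + 4 * suc t     ≤⟨ cuts-lower m (suc t) ⟩
  cut (m + suc t)       ≡⟨ cong cut (+-suc m t) ⟩
  cut (suc m + t)       ∎
  where open ≤-Reasoning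

cut-mono-≤ : ∀ {m m'} → m ≤ m' → cut m ≤ cut m'
cut-mono-≤ m≤m' with m≤n⇒m<n∨m≡n m≤m'
... | inj₁ m<m' = <⇒≤ (cut-mono-< m<m')
... | inj₂ refl = ≤-refl

cut-cancel-< : ∀ {m m'} → cut m < cut m' → m < m'
cut-cancel-< {m} {m'} h with m <? m'
... | yes m<m' = m<m'
... | no m≮m' = ⊥-elim (<⇒≱ h (cut-mono-≤ (≮⇒≥ m≮m')))

record Located (p : ℕ) : Set where
  field
    block : ℕ
    offset : ℕ
    position : p ≡ cut block + offset
    inside : offset < length (g₁ (W block))

locate : ∀ p → Located p
locate zero = record { block = 0 ; offset = 0 ; position = refl ; inside = image-nonempty (W 0) }
locate (suc p) with locate p
... | record { block = m ; offset = o ; position = eq ; inside = o< } with m≤n⇒m<n∨m≡n o<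
...   | inj₁ so< = record { block = m ; offset = suc o ; position = trans (cong suc eq) (sym (+-suc (cut m) o)) ; inside = so< }
...   | inj₂ so≡ = record { block = suc m ; offset = 0 ; position = next-cut ; inside = image-nonempty (W (suc m)) }
  where
  next-cut : suc p ≡ cut (suc m) + 0
  next-cut = begin
    suc p                          ≡⟨ cong suc eq ⟩
    suc (cut m + o)                ≡⟨ +-suc (cut m) o ⟨
    cut m + suc o                  ≡⟨ cong (cut m +_) so≡ ⟩
    cut m + length (g₁ (W m))      ≡⟨ cut-suc m ⟨
    cut (suc m)                    ≡⟨ +-identityʳ (cut (suc m)) ⟨
    cut (suc m) + 0                ∎
    where open ≡-Reasoning

before-next-cut : ∀ m {p o} → p ≡ cut m + o → o < length (g₁ (W m)) → p < cut (suc m)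
before-next-cut m {p} {o} eq o< = subst₂ _<_ (sym eq) (sym (cut-suc m)) (+-monoʳ-< (cut m) o<)

code : A₆ → ℕ
code a = 0
code b = 1
code c = 2
code d = 3
code e = 4
code f = 5

decode : ℕ → A₆
decode 0 = a
decode 1 = b
decode 2 = c
decode 3 = d
decode 4 = e
decode _ = f

decode-code : ∀ x → decode (code x) ≡ x
decode-code a = refl
decode-code b = refl
decode-code c = refl
decode-code d = refl
decode-code e = refl
decode-code f = refl

_≟_ : DecidableEquality A₆
_≟_ = eq? (mk↣ λ {x} {y} same-code → trans (sym (decode-code x)) (trans (cong decode same-code) (decode-code y)))

_≟ʷ_ : DecidableEquality (List A₆)
_≟ʷ_ = ≡-dec _≟_

open import Data.List.Membership.DecPropositional _≟ʷ_ using (_∈_; _∈?_)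

decided : ∀ {A : Set} (A? : Dec A) → does A? ≡ true → A
decided (yes p) _ = p
decided (no _) ()

factorsOf : ℕ → List A₆ → List (List A₆)
factorsOf L w = deduplicate _≟ʷ_ (map (λ o → take L (drop o w)) (upTo (suc (length w ∸ L))))

ClosedUnder-g : ℕ → List (List A₆) → Set
ClosedUnder-g L F = All (λ u → All (λ o → take L (drop o (g u)) ∈ F) (upTo 5)) F

closedUnder-g? : ∀ L F → Dec (ClosedUnder-g L F)
closedUnder-g? L F = all? (λ u → all? (λ o → take L (drop o (g u)) ∈? F) (upTo 5)) F

block-precedes : ∀ m o → 0 < cut m + o → m < cut m + o
block-precedes zero o h = h
block-precedes (suc m) o _ = begin-strict
  suc m                  <⟨ m<m+n (suc m) (s≤s z≤n) ⟩
  4 * suc m              ≤⟨ cuts-lower 0 (suc m) ⟩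
  cut (suc m)            ≤⟨ m≤m+n (cut (suc m)) o ⟩
  cut (suc m) + o        ∎
  where open ≤-Reasoning

-- Factor-closure: if F contains the prefix of length L of W and is closed under g,
-- then F contains every factor of length L of W (each one lies in the image of an earlier one).
all-factors-in : ∀ {L F} K → 2 ≤ L → L ≤ length (P K) → take L (P K) ∈ F → ClosedUnder-g L F → ∀ i → factor i L ∈ F
all-factors-in {L} {F} K 2≤L L≤P prefix∈F closed i = go i (<-wellFounded i)
  where
  go : ∀ i → Acc _<_ i → factor i L ∈ F
  go zero _ = subst (_∈ F) (take-P K L L≤P) prefix∈F
  go (suc i) (acc earlier) = subst (_∈ F) window (applyUpTo⁻ (λ o → o) 5 (lookup closed (go m (earlier m<))) o<5)
    where
    open Located (locate (suc i)) renaming (block to m; offset to o)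
    m< : m < suc i
    m< = subst (m <_) (sym position) (block-precedes m o (subst (0 <_) position (s≤s z≤n)))
    o<5 : o < 5
    o<5 = <-≤-trans inside (proj₂ (image-length (W m)))
    fits : o + L ≤ length (g (factor m L))
    fits = begin
      o + L                        ≡⟨ +-comm o L ⟩
      L + o                        ≤⟨ +-monoʳ-≤ L (≤-trans (≤-pred o<5) (≤-trans (m≤m+n 4 2) (*-monoʳ-≤ 3 2≤L))) ⟩
      4 * L                        ≡⟨ cong (4 *_) (length-factor m L) ⟨
      4 * length (factor m L)      ≤⟨ length-g≥ (factor m L) ⟩
      length (g (factor m L))      ∎
      where open ≤-Reasoning
    window : take L (drop o (g (factor m L))) ≡ factor (suc i) L
    window = begin
      take L (drop o (g (factor m L)))  ≡⟨ cong (take L ∘′ drop o) (g-factor m L) ⟩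
      take L (drop o (factor (cut m) (length (g (factor m L))))) ≡⟨ slice-factor (cut m) o fits ⟩
      factor (cut m + o) L              ≡⟨ cong (λ p → factor p L) position ⟨
      factor (suc i) L                  ∎
      where open ≡-Reasoning

F3 : List (List A₆)
F3 = factorsOf 3 (P 4)

F33 : List (List A₆)
F33 = factorsOf 33 (P 4)

factor3∈F3 : ∀ i → factor i 3 ∈ F3
factor3∈F3 = all-factors-in 4 (s≤s (s≤s z≤n)) (decided (3 ≤? length (P 4)) refl)
  (decided (take 3 (P 4) ∈? F3) refl) (decided (closedUnder-g? 3 F3) refl)

factor33∈F33 : ∀ i → factor i 33 ∈ F33
factor33∈F33 = all-factors-in 4 (s≤s (s≤s z≤n)) (decided (33 ≤? length (P 4)) refl)
  (decided (take 33 (P 4) ∈? F33) refl) (decided (closedUnder-g? 33 F33) refl)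

initial : List A₆ → A₆
initial (a ∷ b ∷ a ∷ _) = a
initial (b ∷ a ∷ b ∷ _) = b
initial (e ∷ a ∷ b ∷ _) = c
initial (f ∷ b ∷ a ∷ _) = d
initial (b ∷ a ∷ c ∷ _) = e
initial (a ∷ b ∷ d ∷ _) = f
initial _ = a

initial-image : ∀ x → initial (take 3 (g₁ x)) ≡ x
initial-image a = refl
initial-image b = refl
initial-image c = refl
initial-image d = refl
initial-image e = refl
initial-image f = refl

image-at-cut : ∀ m → take 3 (g₁ (W m)) ≡ factor (cut m) 3
image-at-cut m = begin
  take 3 (g₁ (W m))                       ≡⟨ cong (take 3) (++-identityʳ (g₁ (W m))) ⟨
  take 3 (g (factor m 1))                 ≡⟨ cong (take 3) (g-factor m 1) ⟩
  take 3 (factor (cut m) (length (g (factor m 1)))) ≡⟨ take-factor (cut m) three≤ ⟩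
  factor (cut m) 3                        ∎
  where
  open ≡-Reasoning
  three≤ : 3 ≤ length (g (factor m 1))
  three≤ = ≤-trans (n≤1+n 3) (length-g≥ (factor m 1))

letter-at-cut : ∀ m m' → factor (cut m) 3 ≡ factor (cut m') 3 → W m ≡ W m'
letter-at-cut m m' same = begin
  W m                                ≡⟨ initial-image (W m) ⟨
  initial (take 3 (g₁ (W m)))        ≡⟨ cong initial (trans (image-at-cut m) (trans same (sym (image-at-cut m')))) ⟩
  initial (take 3 (g₁ (W m')))       ≡⟨ initial-image (W m') ⟩
  W m'                               ∎
  where open ≡-Reasoning

-- Recognisability of cuts. For a word u = x y z, endingAt u o is the window of five letters
-- of g u ending at offset o inside g₁ z; for o = 0 it ends at the cut between g₁ y and g₁ z.

endingAt : List A₆ → ℕ → List A₆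
endingAt u o = take 5 (drop (length (g (take 2 u)) ∸ 5 + o) (g u))

-- F is synchronising if a window ending at a cut never ends strictly inside a letter image.
Synchronising : List (List A₆) → Set
Synchronising F = All (λ u → All (λ v → All (λ o → 0 < o → endingAt u 0 ≢ endingAt v o) (upTo (length (g (drop 2 v))))) F) F

synchronising? : ∀ F → Dec (Synchronising F)
synchronising? F = all? (λ u → all? (λ v → all? (λ o → (0 <? o) →-dec ¬? (endingAt u 0 ≟ʷ endingAt v o)) (upTo (length (g (drop 2 v))))) F) F

ending-window : ∀ m o {p} → o ≤ length (g (factor (2 + m) 1)) → p + 5 ≡ cut (2 + m) + o → endingAt (factor m 3) o ≡ factor p 5
ending-window m o {p} o≤ ends
  with x , five+x≡ ← m≤n⇒∃[o]m+o≡n (≤-trans (m≤m+n 5 3) (length-g≥ (factor m 2))) = begin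
  take 5 (drop (s₂ ∸ 5 + o) (g (factor m 3)))       ≡⟨ cong (λ r → take 5 (drop (r + o) (g (factor m 3)))) s₂∸5 ⟩
  take 5 (drop (x + o) (g (factor m 3)))            ≡⟨ cong (take 5 ∘′ drop (x + o)) (g-factor m 3) ⟩
  take 5 (drop (x + o) (factor (cut m) s₃))         ≡⟨ slice-factor (cut m) (x + o) fits ⟩
  factor (cut m + (x + o)) 5                        ≡⟨ cong (λ q → factor q 5) window-start ⟩
  factor p 5                                        ∎
  where
  open ≡-Reasoning
  s₂ = length (g (factor m 2))
  s₃ = length (g (factor m 3))
  s₂∸5 : s₂ ∸ 5 ≡ x
  s₂∸5 = trans (cong (_∸ 5) (sym five+x≡)) (m+n∸m≡n 5 x)
  s₃≡ : s₃ ≡ s₂ + length (g (factor (2 + m) 1))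
  s₃≡ = trans (cong length (g-++ (factor m 2) (factor (2 + m) 1))) (length-++ (g (factor m 2)))
  regroup : ∀ q x o → q + (5 + x) + o ≡ q + (x + o) + 5
  regroup = solve-∀
  fits : x + o + 5 ≤ s₃
  fits = ≤-trans (≤-reflexive (trans (sym (regroup 0 x o)) (cong (_+ o) five+x≡))) (≤-trans (+-monoʳ-≤ s₂ o≤) (≤-reflexive (sym s₃≡)))
  window-start : cut m + (x + o) ≡ p
  window-start = +-cancelʳ-≡ 5 _ _ (sym (trans ends (trans (cong (_+ o) (trans (cong cut (+-comm 2 m)) (cut-+ m 2)))
                   (trans (cong (λ s → cut m + s + o) (sym five+x≡)) (regroup (cut m) x o)))))

F3-synchronising : Synchronising F3
F3-synchronising = decided (synchronising? F3) refl

not-inside : ∀ m m' o {p p'} → p + 5 ≡ cut (2 + m) → p' + 5 ≡ cut (2 + m') + suc o →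
             suc o < length (g₁ (W (2 + m'))) → factor p 5 ≢ factor p' 5
not-inside m m' o {p} {p'} ends ends' o< same = no-window (s≤s z≤n) (trans window-at-cut (trans same (sym window-inside)))
  where
  o<image : suc o < length (g (factor (2 + m') 1))
  o<image = subst (suc o <_) (cong length (sym (++-identityʳ (g₁ (W (2 + m')))))) o<
  no-window : 0 < suc o → endingAt (factor m 3) 0 ≢ endingAt (factor m' 3) (suc o)
  no-window = applyUpTo⁻ (λ o → o) _ (lookup (lookup F3-synchronising (factor3∈F3 m)) (factor3∈F3 m')) o<image
  window-at-cut : endingAt (factor m 3) 0 ≡ factor p 5
  window-at-cut = ending-window m 0 z≤n (trans ends (sym (+-identityʳ _)))
  window-inside : endingAt (factor m' 3) (suc o) ≡ factor p' 5
  window-inside = ending-window m' (suc o) (<⇒≤ o<image) ends'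

cut-recognised : ∀ m {p p'} → p + 5 ≡ cut (2 + m) → cut 2 ≤ p' + 5 → factor p 5 ≡ factor p' 5 → ∃ λ m' → p' + 5 ≡ cut m'
cut-recognised m {p} {p'} ends beyond same with locate (p' + 5)
... | record { block = μ ; offset = o ; position = at ; inside = o< }
  with m' , refl ← m≤n⇒∃[o]m+o≡n (≤-pred (cut-cancel-< {2} {suc μ} (≤-<-trans beyond (before-next-cut μ at o<))))
  = at-cut o at o<
  where
  at-cut : ∀ o → p' + 5 ≡ cut (2 + m') + o → o < length (g₁ (W (2 + m'))) → ∃ λ m'' → p' + 5 ≡ cut m''
  at-cut zero at _ = 2 + m' , trans at (+-identityʳ _)
  at-cut (suc o) at o< = ⊥-elim (not-inside m m' o ends at o< same)

record Agree (i j n : ℕ) : Set where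
  constructor agree
  field letters : ∀ γ → γ < n → W (i + γ) ≡ W (j + γ)

agree-factor : ∀ {i j} n → Agree i j n → factor i n ≡ factor j n
agree-factor zero _ = refl
agree-factor {i} {j} (suc n) (agree same) =
  cong₂ _∷_ (subst₂ (λ x y → W x ≡ W y) (+-identityʳ i) (+-identityʳ j) (same 0 (s≤s z≤n)))
            (agree-factor n (agree λ γ γ<n → subst₂ (λ x y → W x ≡ W y) (+-suc i γ) (+-suc j γ) (same (suc γ) (s≤s γ<n))))

agree-shift : ∀ {i j n} γ {l} → γ + l ≤ n → Agree i j n → Agree (i + γ) (j + γ) l
agree-shift {i} {j} γ fits (agree same) = agree λ δ δ<l →
  subst₂ (λ x y → W x ≡ W y) (sym (+-assoc i γ δ)) (sym (+-assoc j γ δ)) (same (γ + δ) (<-≤-trans (+-monoʳ-< γ δ<l) fits))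

agree-cons : ∀ {i j n} → W i ≡ W j → Agree (suc i) (suc j) n → Agree i j (suc n)
agree-cons {i} {j} same-head (agree same-tail) = agree λ where
  zero _ → subst₂ (λ x y → W x ≡ W y) (sym (+-identityʳ i)) (sym (+-identityʳ j)) same-head
  (suc γ) (s≤s γ<n) → subst₂ (λ x y → W x ≡ W y) (sym (+-suc i γ)) (sym (+-suc j γ)) (same-tail γ γ<n)

-- W contains a near-square x y x with |x| = n and |y| = k; for k = 0 this is a square.
NearSquare : ℕ → ℕ → Set
NearSquare n k = ∃ λ i → Agree i (i + (n + k)) n

-- For k ≤ 3, threshold k is the length of the longest x such that W contains x y x with |y| = k;
-- only the upper bound is proved below, and threshold 0 = 0 means that W has no squares.
threshold : ℕ → ℕ
threshold 0 = 0
threshold 1 = 2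
threshold 2 = 6
threshold _ = 10

threshold≤10 : ∀ k → threshold k ≤ 10
threshold≤10 0 = z≤n
threshold≤10 1 = s≤s (s≤s z≤n)
threshold≤10 2 = m≤m+n 6 4
threshold≤10 (suc (suc (suc k))) = ≤-refl

NoShortNearSquare : List A₆ → Set
NoShortNearSquare w = All (λ o → All (λ k → All (λ n → threshold k < n →
  take n (drop o w) ≢ take n (drop (o + (n + k)) w)) (upTo 63)) (upTo 4)) (upTo 5)

noShortNearSquare? : ∀ w → Dec (NoShortNearSquare w)
noShortNearSquare? w = all? (λ o → all? (λ k → all? (λ n → (threshold k <? n) →-dec
  ¬? (take n (drop o w) ≟ʷ take n (drop (o + (n + k)) w))) (upTo 63)) (upTo 4)) (upTo 5)

F33-short-free : All (NoShortNearSquare ∘′ g) F33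
F33-short-free = decided (all? (λ u → noShortNearSquare? (g u)) F33) refl

-- Hence there is no near-square with |y| ≤ 3 and threshold |y| < |x| ≤ 62: locate its start in
-- the image of a factor of length 33, which is listed in F33.
short-near-square-free : ∀ {n k} → k ≤ 3 → threshold k < n → n ≤ 62 → ¬ NearSquare n k
short-near-square-free {n} {k} k≤3 long n≤62 (i , same) with locate i
... | record { block = m ; offset = o ; position = at ; inside = o< } =
  lookup-check (trans first-copy (trans (agree-factor n same) (sym second-copy)))
  where
  o≤4 : o ≤ 4
  o≤4 = ≤-pred (<-≤-trans o< (proj₂ (image-length (W m))))
  ℓ = length (g (factor m 33))
  fits : o + (n + k) + n ≤ ℓ
  fits = begin
    o + (n + k) + n           ≤⟨ +-mono-≤ (+-mono-≤ o≤4 (+-mono-≤ n≤62 k≤3)) n≤62 ⟩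
    131                       ≤⟨ n≤1+n 131 ⟩
    4 * 33                    ≡⟨ cong (4 *_) (length-factor m 33) ⟨
    4 * length (factor m 33)  ≤⟨ length-g≥ (factor m 33) ⟩
    ℓ                         ∎
    where open ≤-Reasoning
  image : g (factor m 33) ≡ factor (cut m) ℓ
  image = g-factor m 33
  first-copy : take n (drop o (g (factor m 33))) ≡ factor i n
  first-copy = trans (cong (take n ∘′ drop o) image)
    (trans (slice-factor (cut m) o (≤-trans (+-monoˡ-≤ n (m≤m+n o (n + k))) fits)) (cong (λ p → factor p n) (sym at)))
  second-copy : take n (drop (o + (n + k)) (g (factor m 33))) ≡ factor (i + (n + k)) n
  second-copy = trans (cong (take n ∘′ drop (o + (n + k))) image)
    (trans (slice-factor (cut m) (o + (n + k)) fits) (cong (λ p → factor p n) (trans (sym (+-assoc (cut m) o (n + k))) (cong (_+ (n + k)) (sym at)))))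
  lookup-check : take n (drop o (g (factor m 33))) ≢ take n (drop (o + (n + k)) (g (factor m 33)))
  lookup-check = applyUpTo⁻ (λ n → n) 63
    (applyUpTo⁻ (λ k → k) 4 (applyUpTo⁻ (λ o → o) 5 (lookup F33-short-free (factor33∈F33 m)) (s≤s o≤4)) (s≤s k≤3))
    (s≤s n≤62) long

cut-after : ∀ p → ∃ λ β → p < cut β × cut β ≤ p + 5
cut-after p with locate p
... | record { block = m ; offset = o ; position = at ; inside = o< } = suc m , before-next-cut m at o< , (begin
  cut (suc m)                  ≡⟨ cut-suc m ⟩
  cut m + length (g₁ (W m))    ≤⟨ +-mono-≤ (m≤m+n (cut m) o) (proj₂ (image-length (W m))) ⟩
  cut m + o + 5                ≡⟨ cong (_+ 5) at ⟨
  p + 5                        ∎)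
  where open ≤-Reasoning

first-cut : ∀ i → ∃ λ γ → ∃ λ m → γ ≤ 4 × i + γ + 5 ≡ cut (2 + m)
first-cut i with cut-after (i + 4)
... | β , after , within
  with γ , starts ← m≤n⇒∃[o]m+o≡n after
  with m , refl ← m≤n⇒∃[o]m+o≡n (cut-cancel-< {1} {β} (≤-<-trans (m≤n+m 4 i) after))
  = γ , m , γ≤4 , trans (shift i γ) starts
  where
  shift : ∀ i γ → i + γ + 5 ≡ suc (i + 4) + γ
  shift = solve-∀
  γ≤4 : γ ≤ 4
  γ≤4 = +-cancelˡ-≤ (suc (i + 4)) γ 4 (≤-trans (≤-reflexive starts) (≤-trans within (≤-reflexive (+-suc (i + 4) 4))))

-- In an agreement of length at least 9 at distance D ≥ 3, that cut is carried to a cut,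
-- because the five letters before it form a window ending at a cut.
copied-cut : ∀ {i n D} → 9 ≤ n → 3 ≤ D → Agree i (i + D) n →
             ∃ λ β → ∃ λ β' → i + 5 ≤ cut β × cut β ≤ i + 9 × cut β + D ≡ cut β'
copied-cut {i} {n} {D} 9≤n 3≤D same with first-cut i
... | γ , m , γ≤4 , ends =
  let β' , ends' = cut-recognised m {i + γ} {i + D + γ} ends copy-beyond (agree-factor 5 (agree-shift γ γ+5≤n same))
  in 2 + m , β' , lower , upper , trans (cong (_+ D) (sym ends)) (trans (regroup i γ D) ends')
  where
  regroup : ∀ i γ D → i + γ + 5 + D ≡ i + D + γ + 5
  regroup = solve-∀
  γ+5≤n : γ + 5 ≤ n
  γ+5≤n = ≤-trans (+-monoˡ-≤ 5 γ≤4) 9≤n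
  copy-beyond : 8 ≤ i + D + γ + 5
  copy-beyond = +-monoˡ-≤ 5 (≤-trans 3≤D (≤-trans (m≤n+m D i) (m≤m+n (i + D) γ)))
  lower : i + 5 ≤ cut (2 + m)
  lower = ≤-trans (+-monoˡ-≤ 5 (m≤m+n i γ)) (≤-reflexive ends)
  upper : cut (2 + m) ≤ i + 9
  upper = ≤-trans (≤-reflexive (sym ends)) (≤-trans (+-monoˡ-≤ 5 (+-monoʳ-≤ i γ≤4)) (≤-reflexive (+-assoc i 4 5)))

-- A cut inside the first copy, with room for three letters, whose translate is a cut
-- carries the same letter as its translate (letters are recognised by their images).
copied-letter : ∀ {i n D} β β' → Agree i (i + D) n → i ≤ cut β → cut β + 3 ≤ i + n → cut β + D ≡ cut β' → W β ≡ W β'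
copied-letter {i} {n} {D} β β' same i≤ room copy with γ , starts ← m≤n⇒∃[o]m+o≡n i≤ =
  letter-at-cut β β' (begin
    factor (cut β) 3          ≡⟨ cong (λ p → factor p 3) starts ⟨
    factor (i + γ) 3          ≡⟨ agree-factor 3 (agree-shift γ γ+3≤n same) ⟩
    factor (i + D + γ) 3      ≡⟨ cong (λ p → factor p 3) (trans (regroup i D γ) (trans (cong (_+ D) starts) copy)) ⟩
    factor (cut β') 3         ∎)
  where
  open ≡-Reasoning
  regroup : ∀ i D γ → i + D + γ ≡ i + γ + D
  regroup = solve-∀
  γ+3≤n : γ + 3 ≤ n
  γ+3≤n = +-cancelˡ-≤ i (γ + 3) n (≤-trans (≤-reflexive (sym (+-assoc i γ 3))) (≤-trans (+-monoˡ-≤ 3 (≤-reflexive starts)) room))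

-- Starting from a copied cut, the blocks that end at most one letter beyond the first copy are
-- copied block by block (only the first three letters of a block are needed to recognise it).
copy-blocks : ∀ {i n D} → Agree i (i + D) n → ∀ t {β β'} → i ≤ cut β → cut β + D ≡ cut β' →
              cut (β + t) ≤ suc (i + n) → Agree β β' t
copy-blocks same zero _ _ _ = agree λ _ ()
copy-blocks {i} {n} {D} same (suc t) {β} {β'} i≤ copy inside =
  agree-cons letter (copy-blocks same t (≤-trans i≤ (cut-mono-≤ (n≤1+n β))) next-copy (subst (λ m → cut m ≤ suc (i + n)) (+-suc β t) inside))
  where
  room : cut β + 3 ≤ i + n
  room = ≤-pred (begin
    suc (cut β + 3)        ≡⟨ +-suc (cut β) 3 ⟨
    cut β + 4 * 1          ≤⟨ cuts-lower β 1 ⟩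
    cut (β + 1)            ≤⟨ cut-mono-≤ (+-monoʳ-≤ β (s≤s z≤n)) ⟩
    cut (β + suc t)        ≤⟨ inside ⟩
    suc (i + n)            ∎)
    where open ≤-Reasoning
  letter : W β ≡ W β'
  letter = copied-letter β β' same i≤ room copy
  regroup : ∀ x y D → x + y + D ≡ x + D + y
  regroup = solve-∀
  next-copy : cut (suc β) + D ≡ cut (suc β')
  next-copy = begin
    cut (suc β) + D                    ≡⟨ cong (_+ D) (cut-suc β) ⟩
    cut β + length (g₁ (W β)) + D      ≡⟨ regroup (cut β) _ D ⟩
    cut β + D + length (g₁ (W β))      ≡⟨ cong₂ (λ p x → p + length (g₁ x)) copy letter ⟩
    cut β' + length (g₁ (W β'))        ≡⟨ cut-suc β' ⟨
    cut (suc β')                       ∎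
    where open ≡-Reasoning

-- Let q be the copied cut, with i + 5 ≤ q ≤ i + 9, let r be the
-- cut with r ≤ i + n + 1 < r + 5, with t blocks between q and r, and k' blocks between r
-- and the translate q + (n + k) of q.

gap-bound : ∀ {i n k q r k'} → q ≤ i + 9 → k ≤ 3 → suc (i + n) ≤ r + 4 → r + 4 * k' ≤ q + (n + k) → k' ≤ 3
gap-bound {i} {n} {k} {q} {r} {k'} q≤ k≤3 last gap = ≤-pred (*-cancelˡ-< 4 k' 4 (+-cancelˡ-< (suc (i + n)) _ _ (begin-strict
  suc (i + n) + 4 * k'     ≤⟨ +-monoˡ-≤ (4 * k') last ⟩
  r + 4 + 4 * k'           ≡⟨ swap r 4 (4 * k') ⟩
  r + 4 * k' + 4           ≤⟨ +-monoˡ-≤ 4 gap ⟩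
  q + (n + k) + 4          ≤⟨ +-monoˡ-≤ 4 (+-mono-≤ q≤ (+-monoʳ-≤ n k≤3)) ⟩
  i + 9 + (n + 3) + 4      ≡⟨ regroup i n ⟩
  suc (i + n) + 15         <⟨ +-monoʳ-< (suc (i + n)) (n<1+n 15) ⟩
  suc (i + n) + 4 * 4      ∎)))
  where
  open ≤-Reasoning
  swap : ∀ x y z → x + y + z ≡ x + z + y
  swap = solve-∀
  regroup : ∀ i n → i + 9 + (n + 3) + 4 ≡ suc (i + n) + 15
  regroup = solve-∀

block-count-lower : ∀ {i n q r t} → 63 ≤ n → q ≤ i + 9 → r ≤ q + 5 * t → suc (i + n) ≤ r + 4 → 10 < t
block-count-lower {i} {n} {q} {r} {t} 63≤n q≤ r≤ last = *-cancelˡ-< 5 10 t (+-cancelˡ-< (i + 13) _ _ (begin-strict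
  i + 13 + 5 * 10          ≡⟨ +-assoc i 13 50 ⟩
  i + 63                   <⟨ n<1+n (i + 63) ⟩
  suc (i + 63)             ≤⟨ s≤s (+-monoʳ-≤ i 63≤n) ⟩
  suc (i + n)              ≤⟨ last ⟩
  r + 4                    ≤⟨ +-monoˡ-≤ 4 (≤-trans r≤ (+-monoˡ-≤ (5 * t) q≤)) ⟩
  i + 9 + 5 * t + 4        ≡⟨ regroup i (5 * t) ⟩
  i + 13 + 5 * t           ∎))
  where
  open ≤-Reasoning
  regroup : ∀ i x → i + 9 + x + 4 ≡ i + 13 + x
  regroup = solve-∀

block-count-upper : ∀ {i n q r t} → i + 5 ≤ q → q + 4 * t ≤ r → r ≤ suc (i + n) → t < n
block-count-upper {i} {n} {q} {r} {t} q≥ r≥ last = +-cancelˡ-≤ i (suc t) n (≤-pred (begin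
  suc (i + suc t)          ≤⟨ s≤s (+-monoʳ-≤ i (s≤s (≤-trans (m≤n*m t 4) (m≤n+m (4 * t) 3)))) ⟩
  suc (i + (4 + 4 * t))    ≡⟨ regroup i (4 * t) ⟩
  i + 5 + 4 * t            ≤⟨ +-monoˡ-≤ (4 * t) q≥ ⟩
  q + 4 * t                ≤⟨ r≥ ⟩
  r                        ≤⟨ last ⟩
  suc (i + n)              ∎))
  where
  open ≤-Reasoning
  regroup : ∀ i x → suc (i + (4 + x)) ≡ i + 5 + x
  regroup = solve-∀

Descends : ℕ → Set
Descends n = ∃ λ t → ∃ λ k' → k' ≤ 3 × 10 < t × t < n × NearSquare t k'

-- Assembling the descent once the copied cut (cut β ↦ cut β') and the last cut cut m₂ of the
-- first copy are known: the t blocks from β to m₂ reappear k' blocks after m₂.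
descend : ∀ {i n k β β' m₂} → 63 ≤ n → k ≤ 3 → Agree i (i + (n + k)) n →
          i + 5 ≤ cut β → cut β ≤ i + 9 → cut β + (n + k) ≡ cut β' →
          cut m₂ ≤ suc (i + n) → suc (i + n) ≤ cut m₂ + 4 →
          (∃ λ t → β + t ≡ m₂) → (∃ λ k' → m₂ + k' ≡ β') → Descends n
descend {i} {β = β} 63≤n k≤3 same q≥ q≤ copy last≤ last≥ (t , refl) (k' , refl) =
  t , k' , gap-bound q≤ k≤3 last≥ (≤-trans (cuts-lower (β + t) k') (≤-reflexive (sym copy))) ,
  block-count-lower 63≤n q≤ (cuts-upper β t) last≥ , block-count-upper q≥ (cuts-lower β t) last≤ ,
  β , subst (λ j → Agree β j t) (+-assoc β t k') (copy-blocks same t (≤-trans (m≤m+n i 5) q≥) copy last≤)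

desubstitute : ∀ {n k} → 63 ≤ n → k ≤ 3 → NearSquare n k → Descends n
desubstitute {n} {k} 63≤n k≤3 (i , same) =
  place-cuts (copied-cut 9≤n (≤-trans (≤-trans (m≤m+n 3 60) 63≤n) (m≤m+n n k)) same) (locate (suc (i + n)))
  where
  9≤n : 9 ≤ n
  9≤n = ≤-trans (m≤m+n 9 54) 63≤n
  place-cuts : (∃ λ β → ∃ λ β' → i + 5 ≤ cut β × cut β ≤ i + 9 × cut β + (n + k) ≡ cut β') → Located (suc (i + n)) → Descends n
  place-cuts (β , β' , q≥ , q≤ , copy) record { block = m₂ ; offset = o ; position = at ; inside = o< } =
    descend 63≤n k≤3 same q≥ q≤ copy last≤ last≥ (m≤n⇒∃[o]m+o≡n β≤m₂) (m≤n⇒∃[o]m+o≡n m₂≤β')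
    where
    last≤ : cut m₂ ≤ suc (i + n)
    last≤ = ≤-trans (m≤m+n (cut m₂) o) (≤-reflexive (sym at))
    last≥ : suc (i + n) ≤ cut m₂ + 4
    last≥ = ≤-trans (≤-reflexive at) (+-monoʳ-≤ (cut m₂) (≤-pred (<-≤-trans o< (proj₂ (image-length (W m₂))))))
    β≤m₂ : β ≤ m₂
    β≤m₂ = ≤-pred (cut-cancel-< {β} {suc m₂} (≤-<-trans (≤-trans q≤ (≤-trans (+-monoʳ-≤ i 9≤n) (n≤1+n (i + n))))
                                                         (before-next-cut m₂ at o<)))
    regroup : ∀ i n → suc (i + n) + 4 ≡ i + 5 + n
    regroup = solve-∀
    m₂≤β' : m₂ ≤ β'
    m₂≤β' = <⇒≤ (cut-cancel-< {m₂} {β'} (begin-strict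
      cut m₂                 ≤⟨ last≤ ⟩
      suc (i + n)            <⟨ m<m+n (suc (i + n)) (s≤s z≤n) ⟩
      suc (i + n) + 4        ≡⟨ regroup i n ⟩
      i + 5 + n              ≤⟨ +-mono-≤ q≥ (m≤m+n n k) ⟩
      cut β + (n + k)        ≡⟨ copy ⟩
      cut β'                 ∎))
      where open ≤-Reasoning

-- No near-square x y x with |y| ≤ 3 has |x| > threshold |y|: short ones are excluded by the
-- finite search, long ones descend to shorter ones that are still too long.
no-near-square : ∀ n {k} → k ≤ 3 → threshold k < n → ¬ NearSquare n k
no-near-square n = go n (<-wellFounded n)
  where
  go : ∀ n → Acc _<_ n → ∀ {k} → k ≤ 3 → threshold k < n → ¬ NearSquare n k
  go n (acc shorter) k≤3 long square with n ≤? 62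
  ... | yes n≤62 = short-near-square-free k≤3 long n≤62 square
  ... | no n≰62 =
    let t , k' , k'≤3 , 10<t , t<n , square' = desubstitute (≰⇒> n≰62) k≤3 square
    in go t (shorter t<n) k'≤3 (≤-<-trans (threshold≤10 k') 10<t) square'

square-free : ∀ (𝐠 : InfWord) → IsFixedPointFrom-a 𝐠 → SquareFree 𝐠
square-free 𝐠 h𝐠 (i , n , 0<n , square) = no-near-square n z≤n 0<n (i , agree same)
  where
  same : ∀ γ → γ < n → W (i + γ) ≡ W (i + (n + 0) + γ)
  same γ γ<n = begin
    W (i + γ)               ≡⟨ fixedPoint-unique 𝐠 h𝐠 (i + γ) ⟩
    𝐠 (i + γ)               ≡⟨ square γ γ<n ⟩
    𝐠 (i + n + γ)           ≡⟨ fixedPoint-unique 𝐠 h𝐠 (i + n + γ) ⟨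
    W (i + n + γ)           ≡⟨ cong (λ m → W (i + m + γ)) (+-identityʳ n) ⟨
    W (i + (n + 0) + γ)     ∎
    where open ≡-Reasoning

corollary1 : (∃ λ (𝐠 : InfWord) → IsFixedPointFrom-a 𝐠) × (∀ (𝐠 : InfWord) → IsFixedPointFrom-a 𝐠 → SquareFree 𝐠)
corollary1 = (W , fixedPoint) , square-free
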